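{- Let $G=(V,E)$ be a graph and $v\in V$. Then $$\mathrm{ID}(G,x)=\mathrm{ID}(G-v,x)+\mathrm{ID}(G\odot v,x)-\mathrm{ID}((G\odot v)-v,x).$$
   Context: All graphs are finite, simple and undirected. $G-v$ deletes $v$ and its incident edges. $G\odot v$ is obtained from $G$ by removing every edge whose two endpoints are both neighbors of $v$. A set $W\subseteq V$ is an independent dominating set of $G=(V,E)$ if every vertex of $V\setminus W$ is adjacent to at least one vertex of $W$ and no two vertices of $W$ are adjacent. The independent domination polynomial is $\mathrm{ID}(G,x)=\sum_{W}x^{|W|}$, the sum over all independent dominating sets $W$ of $G$. -}

module Defs where

open import Data.Nat using (ℕ; zero; suc)
open import Data.Bool using (Bool; true; false; _∧_; _∨_; not; if_then_else_)
open import Data.Bool.Properties using (∧-comm)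
open import Data.Fin using (Fin; punchIn)
open import Data.List using (List; []; _∷_; _++_; map; allFin; length; filter)
open import Data.Bool.ListAction using (all; any)
open import Data.Integer using (ℤ; +_)
open import Relation.Binary.PropositionalEquality using (_≡_; refl; cong; cong₂)
open import Relation.Nullary.Decidable using ()
open import Data.Fin using (zero; suc)

record Graph (n : ℕ) : Set where
  field
    adj    : Fin n → Fin n → Bool
    sym    : ∀ i j → adj i j ≡ adj j i
    irrefl : ∀ i → adj i i ≡ false
open Graph public

_−_ : ∀ {n} → Graph (suc n) → Fin (suc n) → Graph n
adj (G − v) i j = adj G (punchIn v i) (punchIn v j)
sym (G − v) i j = sym G (punchIn v i) (punchIn v j)
irrefl (G − v) i = irrefl G (punchIn v i)

_⊙_ : ∀ {n} → Graph n → Fin n → Graph n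
adj (G ⊙ v) i j = adj G i j ∧ not (adj G v i ∧ adj G v j)
sym (G ⊙ v) i j = cong₂ _∧_ (sym G i j) (cong not (∧-comm (adj G v i) (adj G v j)))
irrefl (G ⊙ v) i = cong (_∧ not (adj G v i ∧ adj G v i)) (irrefl G i)

Subset : ℕ → Set
Subset n = Fin n → Bool

allSubsets : (n : ℕ) → List (Subset n)
allSubsets zero = (λ ()) ∷ []
allSubsets (suc n) =
  map (λ W → λ { zero → false ; (suc i) → W i }) (allSubsets n) ++
  map (λ W → λ { zero → true  ; (suc i) → W i }) (allSubsets n)

size : ∀ {n} → Subset n → ℕ
size {n} W = length (filter (λ i → Data.Bool._≟_ (W i) true) (allFin n))
  where import Data.Bool

isIndependent : ∀ {n} → Graph n → Subset n → Bool
isIndependent {n} G W =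
  all (λ i → all (λ j → not (W i ∧ W j ∧ adj G i j)) (allFin n)) (allFin n)

isDominating : ∀ {n} → Graph n → Subset n → Bool
isDominating {n} G W =
  all (λ u → W u ∨ any (λ w → W w ∧ adj G u w) (allFin n)) (allFin n)

isIndepDominating : ∀ {n} → Graph n → Subset n → Bool
isIndepDominating G W = isIndependent G W ∧ isDominating G W

-- The independent domination polynomial ID(G,x), represented by its
-- coefficient sequence: ID G k = number of independent dominating sets
-- of G of size k (as an integer, so that polynomial subtraction is available).
ID : ∀ {n} → Graph n → ℕ → ℤ
ID {n} G k = + length (filter (λ W → Data.Bool._≟_ (isIndepDominating G W ∧ sizeIs W) true) (allSubsets n))
  where
    import Data.Bool
    open import Data.Nat using (_≡ᵇ_)
    sizeIs : Subset n → Bool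
    sizeIs W = size W ≡ᵇ k

module Submission where

-- Write H = G ⊙ v and, for a vertex set W of G, W⁻ = removeAt W v for its trace on G − v.
-- We compare the four counts subset by subset. For a set W of size k:
--   (a) if v ∈ W, W is an IDS of G iff it is one of H: an independent set containing v has
--       no member in N(v), and H differs from G only by edges inside N(v);
--   (b) if v ∉ W, W is an IDS of G iff W⁻ is an IDS of G − v and W⁻ meets N(v); the same
--       holds for H, whose neighbourhood of v is that of G;
--   (c) if W⁻ misses N(v), W⁻ is an IDS of G − v iff it is one of H − v.
-- Hence, for every W (with [·] the indicator of a condition),
--   [W ∈ ID(G)] + [v ∉ W, W⁻ ∈ ID(H − v)] = [v ∉ W, W⁻ ∈ ID(G − v)] + [W ∈ ID(H)].
-- Summing over all W, and using that the sets avoiding v correspond to the vertex sets of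
-- G − v (with the same size), gives ID(G) + ID(H − v) = ID(G − v) + ID(H) in ℕ; the theorem
-- is this identity read in ℤ.

open import Defs
open import Data.Nat using (ℕ; suc)
open import Data.Fin using (Fin)
open import Data.Integer using (_+_; _-_)
open import Relation.Binary.PropositionalEquality using (_≡_)

open import Algebra.Bundles using (CommutativeMonoid)
open import Level using (0ℓ)
import Algebra.Properties.CommutativeSemigroup as CommutativeSemigroupProperties
open import Data.Bool using (Bool; true; false; T; not; _∧_; _∨_; _≟_)
open import Data.Bool.ListAction using (all; any; and; or)
open import Data.Bool.Properties
  using ( ∧-assoc; ∧-comm; ∧-zeroʳ; ∧-identityʳ; T-∧; T-not-≡
        ; ∧-commutativeMonoid; ∨-commutativeMonoid)
open import Data.Empty using (⊥-elim)
open import Data.Fin using (zero; suc; punchIn)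
open import Data.Integer using (+_; -_; 0ℤ)
import Data.Integer.Properties as ℤ
open import Data.List using (List; []; _∷_; _++_; map; foldr; tabulate; allFin; length; filter)
open import Data.List.Properties using (map-tabulate; map-cong; map-++; map-∘)
open import Data.List.Relation.Unary.All.Properties using (all⁺) renaming (tabulate⁻ to All-tabulate⁻)
open import Data.List.Relation.Unary.Any.Properties using (any⁺) renaming (tabulate⁺ to Any-tabulate⁺)
import Data.Nat as ℕ
open import Data.Nat using (_≡ᵇ_)
open import Data.Nat.ListAction using (sum)
open import Data.Nat.ListAction.Properties using (sum-++)
open import Data.Nat.Properties using (+-comm; +-identityʳ; +-commutativeSemigroup; +-0-commutativeMonoid)
open import Data.Product using (_,_; proj₁)
open import Data.Vec.Functional using (removeAt) renaming (_∷_ to _◂_)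
open import Function using (_∘_; id; Equivalence)
open import Relation.Binary.PropositionalEquality
  using (refl; trans; cong; cong₂; subst; _≗_; module ≡-Reasoning)
  renaming (sym to ≡-sym)
open import Relation.Nullary using (¬_)

open ≡-Reasoning
open Equivalence using (to; from)

T-ext : ∀ {a b : Bool} → (T a → T b) → (T b → T a) → a ≡ b
T-ext {false} {false} _ _ = refl
T-ext {false} {true}  _ g = ⊥-elim (g _)
T-ext {true}  {false} f _ = ⊥-elim (f _)
T-ext {true}  {true}  _ _ = refl

foldr-tabulate-punchIn : ∀ {A : Set} (_∙_ : A → A → A) →
  (∀ x y z → x ∙ (y ∙ z) ≡ y ∙ (x ∙ z)) → (e : A) →
  ∀ {n} (f : Fin (suc n) → A) (v : Fin (suc n)) →
  foldr _∙_ e (tabulate f) ≡ f v ∙ foldr _∙_ e (tabulate (f ∘ punchIn v))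
foldr-tabulate-punchIn _∙_ swap e f zero = refl
foldr-tabulate-punchIn _∙_ swap e {suc n} f (suc v) =
  trans (cong (f zero ∙_) (foldr-tabulate-punchIn _∙_ swap e (f ∘ suc) v))
        (swap (f zero) (f (suc v)) _)

foldr-allFin-punchIn : ∀ {A : Set} (_∙_ : A → A → A) →
  (∀ x y z → x ∙ (y ∙ z) ≡ y ∙ (x ∙ z)) → (e : A) →
  ∀ {n} (f : Fin (suc n) → A) (v : Fin (suc n)) →
  foldr _∙_ e (map f (allFin (suc n))) ≡ f v ∙ foldr _∙_ e (map (f ∘ punchIn v) (allFin n))
foldr-allFin-punchIn _∙_ swap e {n} f v = begin
  foldr _∙_ e (map f (allFin (suc n)))
    ≡⟨ cong (foldr _∙_ e) (map-tabulate id f) ⟩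
  foldr _∙_ e (tabulate f)
    ≡⟨ foldr-tabulate-punchIn _∙_ swap e f v ⟩
  f v ∙ foldr _∙_ e (tabulate (f ∘ punchIn v))
    ≡⟨ cong (λ xs → f v ∙ foldr _∙_ e xs) (map-tabulate id (f ∘ punchIn v)) ⟨
  f v ∙ foldr _∙_ e (map (f ∘ punchIn v) (allFin n)) ∎

leftComm : ∀ (M : CommutativeMonoid 0ℓ 0ℓ) → let open CommutativeMonoid M in
  ∀ x y z → x ∙ (y ∙ z) ≈ y ∙ (x ∙ z)
leftComm M = CommutativeSemigroupProperties.x∙yz≈y∙xz (CommutativeMonoid.commutativeSemigroup M)

all-punchIn : ∀ {n} (p : Fin (suc n) → Bool) (v : Fin (suc n)) →
  all p (allFin (suc n)) ≡ p v ∧ all (p ∘ punchIn v) (allFin n)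
all-punchIn = foldr-allFin-punchIn _∧_ (leftComm ∧-commutativeMonoid) true

any-punchIn : ∀ {n} (p : Fin (suc n) → Bool) (v : Fin (suc n)) →
  any p (allFin (suc n)) ≡ p v ∨ any (p ∘ punchIn v) (allFin n)
any-punchIn = foldr-allFin-punchIn _∨_ (leftComm ∨-commutativeMonoid) false

sum-punchIn : ∀ {n} (f : Fin (suc n) → ℕ) (v : Fin (suc n)) →
  sum (map f (allFin (suc n))) ≡ f v ℕ.+ sum (map (f ∘ punchIn v) (allFin n))
sum-punchIn = foldr-allFin-punchIn ℕ._+_ (leftComm +-0-commutativeMonoid) 0

all-const-true : ∀ {A : Set} (xs : List A) → all (λ _ → true) xs ≡ true
all-const-true []       = refl
all-const-true (_ ∷ xs) = all-const-true xs

oneIf : Bool → ℕ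
oneIf true  = 1
oneIf false = 0

count : ∀ {A : Set} → (A → Bool) → List A → ℕ
count P xs = sum (map (oneIf ∘ P) xs)

length-filter≡count : ∀ {A : Set} (P : A → Bool) (xs : List A) →
  length (filter (λ x → P x ≟ true) xs) ≡ count P xs
length-filter≡count P [] = refl
length-filter≡count P (x ∷ xs) with P x
... | true  = cong suc (length-filter≡count P xs)
... | false = length-filter≡count P xs

count-++ : ∀ {A : Set} (P : A → Bool) (xs ys : List A) →
  count P (xs ++ ys) ≡ count P xs ℕ.+ count P ys
count-++ P xs ys =
  trans (cong sum (map-++ (oneIf ∘ P) xs ys)) (sum-++ (map (oneIf ∘ P) xs) (map (oneIf ∘ P) ys))

count-map : ∀ {A B : Set} (P : B → Bool) (f : A → B) (xs : List A) →
  count P (map f xs) ≡ count (P ∘ f) xs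
count-map P f xs = cong sum (≡-sym (map-∘ xs))

count-cong : ∀ {A : Set} {P Q : A → Bool} → P ≗ Q → (xs : List A) → count P xs ≡ count Q xs
count-cong P≗Q xs = cong sum (map-cong (cong oneIf ∘ P≗Q) xs)

count-none : ∀ {A : Set} (xs : List A) → count (λ _ → false) xs ≡ 0
count-none []       = refl
count-none (_ ∷ xs) = count-none xs

count-exchange : ∀ {A : Set} (P Q R S : A → Bool) →
  (∀ x → oneIf (P x) ℕ.+ oneIf (Q x) ≡ oneIf (R x) ℕ.+ oneIf (S x)) → (xs : List A) →
  count P xs ℕ.+ count Q xs ≡ count R xs ℕ.+ count S xs
count-exchange P Q R S pointwise []       = refl
count-exchange P Q R S pointwise (x ∷ xs) = begin
  (oneIf (P x) ℕ.+ count P xs) ℕ.+ (oneIf (Q x) ℕ.+ count Q xs)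
    ≡⟨ +-interchange (oneIf (P x)) _ _ _ ⟩
  (oneIf (P x) ℕ.+ oneIf (Q x)) ℕ.+ (count P xs ℕ.+ count Q xs)
    ≡⟨ cong₂ ℕ._+_ (pointwise x) (count-exchange P Q R S pointwise xs) ⟩
  (oneIf (R x) ℕ.+ oneIf (S x)) ℕ.+ (count R xs ℕ.+ count S xs)
    ≡⟨ +-interchange (oneIf (R x)) _ _ _ ⟩
  (oneIf (R x) ℕ.+ count R xs) ℕ.+ (oneIf (S x) ℕ.+ count S xs) ∎
  where open CommutativeSemigroupProperties +-commutativeSemigroup renaming (interchange to +-interchange)

Extensional : ∀ {n} → (Subset n → Bool) → Set
Extensional P = ∀ {W W′} → W ≗ W′ → P W ≡ P W′

◂-cong : ∀ {n} (b : Bool) {W W′ : Subset n} → W ≗ W′ → (b ◂ W) ≗ (b ◂ W′)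
◂-cong b W≗W′ zero    = refl
◂-cong b W≗W′ (suc i) = W≗W′ i

count-subsets-suc : ∀ {n} (P : Subset (suc n) → Bool) → Extensional P →
  count P (allSubsets (suc n)) ≡
  count (λ W → P (false ◂ W)) (allSubsets n) ℕ.+ count (λ W → P (true ◂ W)) (allSubsets n)
count-subsets-suc {n} P ext =
  trans (count-++ P (map _ (allSubsets n)) (map _ (allSubsets n)))
        (cong₂ ℕ._+_ (half false _ λ W → λ { zero → refl ; (suc i) → refl })
                     (half true  _ λ W → λ { zero → refl ; (suc i) → refl }))
  where
  half : ∀ b (f : Subset n → Subset (suc n)) → (∀ W → f W ≗ (b ◂ W)) →
    count P (map f (allSubsets n)) ≡ count (λ W → P (b ◂ W)) (allSubsets n)
  half b f prepends = trans (count-map P f (allSubsets n)) (count-cong (ext ∘ prepends) (allSubsets n))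

avoiding : ∀ {n} → Fin (suc n) → (Subset n → Bool) → Subset (suc n) → Bool
avoiding v Q W = not (W v) ∧ Q (removeAt W v)

avoiding-ext : ∀ {n} (v : Fin (suc n)) {Q : Subset n → Bool} → Extensional Q → Extensional (avoiding v Q)
avoiding-ext v ext W≗W′ = cong₂ _∧_ (cong not (W≗W′ v)) (ext (W≗W′ ∘ punchIn v))

count-avoiding : ∀ {n} (v : Fin (suc n)) (Q : Subset n → Bool) → Extensional Q →
  count (avoiding v Q) (allSubsets (suc n)) ≡ count Q (allSubsets n)
count-avoiding {n} zero Q ext = begin
  count (avoiding zero Q) (allSubsets (suc n))
    ≡⟨ count-subsets-suc (avoiding zero Q) (avoiding-ext zero ext) ⟩
  count Q (allSubsets n) ℕ.+ count (λ _ → false) (allSubsets n)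
    ≡⟨ cong (count Q (allSubsets n) ℕ.+_) (count-none (allSubsets n)) ⟩
  count Q (allSubsets n) ℕ.+ 0
    ≡⟨ +-identityʳ _ ⟩
  count Q (allSubsets n) ∎
count-avoiding {suc n} (suc v) Q ext = begin
  count (avoiding (suc v) Q) (allSubsets (suc (suc n)))
    ≡⟨ count-subsets-suc (avoiding (suc v) Q) (avoiding-ext (suc v) ext) ⟩
  count (λ W → avoiding (suc v) Q (false ◂ W)) (allSubsets (suc n)) ℕ.+
  count (λ W → avoiding (suc v) Q (true ◂ W)) (allSubsets (suc n))
    ≡⟨ cong₂ ℕ._+_ (count-cong (trace false) (allSubsets (suc n)))
                   (count-cong (trace true) (allSubsets (suc n))) ⟩
  count (avoiding v (λ U → Q (false ◂ U))) (allSubsets (suc n)) ℕ.+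
  count (avoiding v (λ U → Q (true ◂ U))) (allSubsets (suc n))
    ≡⟨ cong₂ ℕ._+_ (count-avoiding v _ (ext ∘ ◂-cong false))
                   (count-avoiding v _ (ext ∘ ◂-cong true)) ⟩
  count (λ U → Q (false ◂ U)) (allSubsets n) ℕ.+ count (λ U → Q (true ◂ U)) (allSubsets n)
    ≡⟨ count-subsets-suc Q ext ⟨
  count Q (allSubsets (suc n)) ∎
  where
  trace : ∀ b (W : Subset (suc n)) → avoiding (suc v) Q (b ◂ W) ≡ avoiding v (λ U → Q (b ◂ U)) W
  trace b W = cong (not (W v) ∧_) (ext λ { zero → refl ; (suc i) → refl })

size≡count : ∀ {n} (W : Subset n) → size W ≡ count W (allFin n)
size≡count {n} W = length-filter≡count W (allFin n)

size-cong : ∀ {n} {W W′ : Subset n} → W ≗ W′ → size W ≡ size W′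
size-cong {n} {W} {W′} W≗W′ =
  trans (size≡count W) (trans (count-cong W≗W′ (allFin n)) (≡-sym (size≡count W′)))

size-removeAt : ∀ {n} (W : Subset (suc n)) (v : Fin (suc n)) →
  size W ≡ oneIf (W v) ℕ.+ size (removeAt W v)
size-removeAt {n} W v = begin
  size W                                           ≡⟨ size≡count W ⟩
  count W (allFin (suc n))                         ≡⟨ sum-punchIn (oneIf ∘ W) v ⟩
  oneIf (W v) ℕ.+ count (removeAt W v) (allFin n)  ≡⟨ cong (oneIf (W v) ℕ.+_) (size≡count (removeAt W v)) ⟨
  oneIf (W v) ℕ.+ size (removeAt W v)              ∎

isIndepDominating-cong : ∀ {n} (G₁ G₂ : Graph n) {W₁ W₂ : Subset n} → W₁ ≗ W₂ →
  (∀ i j → T (W₁ j) → adj G₁ i j ≡ adj G₂ i j) →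
  isIndepDominating G₁ W₁ ≡ isIndepDominating G₂ W₂
isIndepDominating-cong {n} G₁ G₂ {W₁} {W₂} W₁≗W₂ agree =
  cong₂ _∧_ (all-cong λ i → all-cong λ j → cong not (cong₂ _∧_ (W₁≗W₂ i) (edgeInto i j)))
            (all-cong λ u → cong₂ _∨_ (W₁≗W₂ u) (cong or (map-cong (edgeInto u) (allFin n))))
  where
  all-cong : ∀ {p q : Fin n → Bool} → p ≗ q → all p (allFin n) ≡ all q (allFin n)
  all-cong p≗q = cong and (map-cong p≗q (allFin n))
  guarded : ∀ b {x y : Bool} → (T b → x ≡ y) → b ∧ x ≡ b ∧ y
  guarded false _   = refl
  guarded true  x≡y = x≡y _
  edgeInto : ∀ i j → (W₁ j ∧ adj G₁ i j) ≡ (W₂ j ∧ adj G₂ i j)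
  edgeInto i j = trans (guarded (W₁ j) (agree i j)) (cong (_∧ adj G₂ i j) (W₁≗W₂ j))

independent-nonadjacent : ∀ {n} (G : Graph n) (W : Subset n) → T (isIndependent G W) →
  ∀ {i j} → T (W i) → T (W j) → ¬ T (adj G i j)
independent-nonadjacent {n} G W indep {i} {j} wi wj ij =
  subst T (to T-not-≡ entry) (from T-∧ (wi , from T-∧ (wj , ij)))
  where
  rowsHold : ∀ i → T (all (λ j → not (W i ∧ W j ∧ adj G i j)) (allFin n))
  rowsHold = All-tabulate⁻ (all⁺ _ (allFin n) indep)
  entry : T (not (W i ∧ W j ∧ adj G i j))
  entry = All-tabulate⁻ (all⁺ _ (allFin n) (rowsHold i)) j

⊙-keeps : ∀ {n} (G : Graph n) (v : Fin n) {i j} → ¬ T (adj G v j) → adj (G ⊙ v) i j ≡ adj G i j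
⊙-keeps G v {i} {j} vj∉E with adj G v j
... | true  = ⊥-elim (vj∉E _)
... | false = trans (cong (λ b → adj G i j ∧ not b) (∧-zeroʳ (adj G v i))) (∧-identityʳ (adj G i j))

⊙-neighbourhood : ∀ {n} (G : Graph n) (v j : Fin n) → adj (G ⊙ v) v j ≡ adj G v j
⊙-neighbourhood G v j =
  trans (cong (λ b → adj G v j ∧ not (b ∧ adj G v j)) (irrefl G v)) (∧-identityʳ (adj G v j))

isIndepDominating-⊙-member : ∀ {n} (G : Graph n) (v : Fin n) (W : Subset n) → T (W v) →
  isIndepDominating G W ≡ isIndepDominating (G ⊙ v) W
isIndepDominating-⊙-member G v W wv = T-ext
  (λ ids → subst T (agreeIfMisses (missesG ids)) ids)
  (λ ids → subst T (≡-sym (agreeIfMisses (missesH ids))) ids)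
  where
  agreeIfMisses : (∀ {j} → T (W j) → ¬ T (adj G v j)) →
    isIndepDominating G W ≡ isIndepDominating (G ⊙ v) W
  agreeIfMisses misses =
    isIndepDominating-cong G (G ⊙ v) (λ _ → refl) (λ i j wj → ≡-sym (⊙-keeps G v (misses wj)))
  independent : ∀ H → T (isIndepDominating H W) → T (isIndependent H W)
  independent H = proj₁ ∘ to T-∧
  missesG : T (isIndepDominating G W) → ∀ {j} → T (W j) → ¬ T (adj G v j)
  missesG ids = independent-nonadjacent G W (independent G ids) wv
  missesH : T (isIndepDominating (G ⊙ v) W) → ∀ {j} → T (W j) → ¬ T (adj G v j)
  missesH ids {j} wj = independent-nonadjacent (G ⊙ v) W (independent (G ⊙ v) ids) wv wj
                     ∘ subst T (≡-sym (⊙-neighbourhood G v j))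

meetsNeighbourhood : ∀ {n} → Graph (suc n) → Fin (suc n) → Subset n → Bool
meetsNeighbourhood {n} G v U = any (λ i → U i ∧ adj G v (punchIn v i)) (allFin n)

meetsNeighbourhood-⊙ : ∀ {n} (G : Graph (suc n)) (v : Fin (suc n)) (U : Subset n) →
  meetsNeighbourhood (G ⊙ v) v U ≡ meetsNeighbourhood G v U
meetsNeighbourhood-⊙ {n} G v U =
  cong or (map-cong (λ i → cong (U i ∧_) (⊙-neighbourhood G v (punchIn v i))) (allFin n))

isIndependent-avoiding : ∀ {n} (G : Graph (suc n)) (v : Fin (suc n)) (W : Subset (suc n)) →
  W v ≡ false → isIndependent G W ≡ isIndependent (G − v) (removeAt W v)
isIndependent-avoiding {n} G v W wv = begin
  all row (allFin (suc n))
    ≡⟨ all-punchIn row v ⟩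
  row v ∧ all (row ∘ punchIn v) (allFin n)
    ≡⟨ cong₂ _∧_ row-v (cong and (map-cong row-punchIn (allFin n))) ⟩
  isIndependent (G − v) (removeAt W v) ∎
  where
  entry : Fin (suc n) → Fin (suc n) → Bool
  entry i j = not (W i ∧ W j ∧ adj G i j)
  row : Fin (suc n) → Bool
  row i = all (entry i) (allFin (suc n))
  -- the row of v imposes nothing, as v ∉ W
  row-v : row v ≡ true
  row-v = trans (cong (λ b → all (λ j → not (b ∧ W j ∧ adj G v j)) (allFin (suc n))) wv)
                (all-const-true (allFin (suc n)))
  row-punchIn : ∀ i → row (punchIn v i) ≡ all (entry (punchIn v i) ∘ punchIn v) (allFin n)
  row-punchIn i = trans (all-punchIn (entry (punchIn v i)) v)
                        (cong (_∧ all (entry (punchIn v i) ∘ punchIn v) (allFin n)) column-v)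
    where
    column-v : entry (punchIn v i) v ≡ true
    column-v = trans (cong (λ b → not (W (punchIn v i) ∧ b ∧ adj G (punchIn v i) v)) wv)
                     (cong not (∧-zeroʳ (W (punchIn v i))))

isDominating-avoiding : ∀ {n} (G : Graph (suc n)) (v : Fin (suc n)) (W : Subset (suc n)) →
  W v ≡ false →
  isDominating G W ≡ meetsNeighbourhood G v (removeAt W v) ∧ isDominating (G − v) (removeAt W v)
isDominating-avoiding {n} G v W wv = begin
  all dominated (allFin (suc n))
    ≡⟨ all-punchIn dominated v ⟩
  dominated v ∧ all (dominated ∘ punchIn v) (allFin n)
    ≡⟨ cong₂ _∧_ dominated-v (cong and (map-cong dominated-punchIn (allFin n))) ⟩
  meetsNeighbourhood G v (removeAt W v) ∧ isDominating (G − v) (removeAt W v) ∎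
  where
  neighbourIn : Fin (suc n) → Fin (suc n) → Bool
  neighbourIn u w = W w ∧ adj G u w
  dominated : Fin (suc n) → Bool
  dominated u = W u ∨ any (neighbourIn u) (allFin (suc n))
  dominated-v : dominated v ≡ meetsNeighbourhood G v (removeAt W v)
  dominated-v = trans (cong (W v ∨_) (any-punchIn (neighbourIn v) v))
    (cong (λ b → b ∨ ((b ∧ adj G v v) ∨ meetsNeighbourhood G v (removeAt W v))) wv)
  -- another vertex is never dominated by v alone, as v ∉ W
  dominated-punchIn : ∀ u →
    dominated (punchIn v u) ≡ W (punchIn v u) ∨ any (neighbourIn (punchIn v u) ∘ punchIn v) (allFin n)
  dominated-punchIn u = cong (W (punchIn v u) ∨_)
    (trans (any-punchIn (neighbourIn (punchIn v u)) v) (cong (λ b → (b ∧ adj G (punchIn v u) v) ∨ rest) wv))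
    where
    rest : Bool
    rest = any (neighbourIn (punchIn v u) ∘ punchIn v) (allFin n)

isIndepDominating-avoiding : ∀ {n} (G : Graph (suc n)) (v : Fin (suc n)) (W : Subset (suc n)) →
  W v ≡ false → isIndepDominating G W ≡
    isIndepDominating (G − v) (removeAt W v) ∧ meetsNeighbourhood G v (removeAt W v)
isIndepDominating-avoiding G v W wv = begin
  isIndependent G W ∧ isDominating G W
    ≡⟨ cong₂ _∧_ (isIndependent-avoiding G v W wv) (isDominating-avoiding G v W wv) ⟩
  ind ∧ (meets ∧ dom)   ≡⟨ cong (ind ∧_) (∧-comm meets dom) ⟩
  ind ∧ (dom ∧ meets)   ≡⟨ ∧-assoc ind dom meets ⟨
  (ind ∧ dom) ∧ meets   ∎
  where
  ind dom meets : Bool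
  ind   = isIndependent (G − v) (removeAt W v)
  dom   = isDominating (G − v) (removeAt W v)
  meets = meetsNeighbourhood G v (removeAt W v)

isIndepDominating-⊙-deleted : ∀ {n} (G : Graph (suc n)) (v : Fin (suc n)) (U : Subset n) →
  meetsNeighbourhood G v U ≡ false →
  isIndepDominating (G − v) U ≡ isIndepDominating ((G ⊙ v) − v) U
isIndepDominating-⊙-deleted {n} G v U misses =
  isIndepDominating-cong (G − v) ((G ⊙ v) − v) (λ _ → refl)
    (λ i j uj → ≡-sym (⊙-keeps G v (notNeighbour uj)))
  where
  notNeighbour : ∀ {j} → T (U j) → ¬ T (adj G v (punchIn v j))
  notNeighbour {j} uj vj = subst T misses (any⁺ _ (Any-tabulate⁺ j (from T-∧ (uj , vj))))

isIDSetOfSize : ∀ {n} → Graph n → ℕ → Subset n → Bool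
isIDSetOfSize G k W = isIndepDominating G W ∧ (size W ≡ᵇ k)

isIDSetOfSize-ext : ∀ {n} (G : Graph n) (k : ℕ) → Extensional (isIDSetOfSize G k)
isIDSetOfSize-ext G k W≗W′ =
  cong₂ _∧_ (isIndepDominating-cong G G W≗W′ (λ _ _ _ → refl)) (cong (_≡ᵇ k) (size-cong W≗W′))

idCount : ∀ {n} → Graph n → ℕ → ℕ
idCount {n} G k = count (isIDSetOfSize G k) (allSubsets n)

ID≡idCount : ∀ {n} (G : Graph n) (k : ℕ) → ID G k ≡ + idCount G k
ID≡idCount {n} G k = cong +_ (length-filter≡count (isIDSetOfSize G k) (allSubsets n))

isIDSetOfSize-avoiding : ∀ {n} (G : Graph (suc n)) (v : Fin (suc n)) (k : ℕ) (W : Subset (suc n)) →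
  W v ≡ false → isIDSetOfSize G k W ≡
    (isIndepDominating (G − v) (removeAt W v) ∧ meetsNeighbourhood G v (removeAt W v))
      ∧ (size (removeAt W v) ≡ᵇ k)
isIDSetOfSize-avoiding G v k W wv =
  cong₂ _∧_ (isIndepDominating-avoiding G v W wv)
            (cong (_≡ᵇ k) (trans (size-removeAt W v) (cong (λ b → oneIf b ℕ.+ size (removeAt W v)) wv)))

-- The Boolean bookkeeping of the case v ∉ W, with a, b the IDS-tests of the trace in G − v
-- and (G ⊙ v) − v, m "the trace meets N(v)" and s the size test: a and b agree when m fails.
oneIf-exchange : ∀ a b m s → (m ≡ false → a ≡ b) →
  oneIf ((a ∧ m) ∧ s) ℕ.+ oneIf (b ∧ s) ≡ oneIf (a ∧ s) ℕ.+ oneIf ((b ∧ m) ∧ s)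
oneIf-exchange a b true  s _ rewrite ∧-identityʳ a | ∧-identityʳ b = refl
oneIf-exchange a b false s a≡b rewrite a≡b refl | ∧-zeroʳ b = +-comm 0 (oneIf (b ∧ s))

recurrence-at : ∀ {n} (G : Graph (suc n)) (v : Fin (suc n)) (k : ℕ) (W : Subset (suc n)) →
  oneIf (isIDSetOfSize G k W) ℕ.+ oneIf (avoiding v (isIDSetOfSize ((G ⊙ v) − v) k) W) ≡
  oneIf (avoiding v (isIDSetOfSize (G − v) k) W) ℕ.+ oneIf (isIDSetOfSize (G ⊙ v) k W)
recurrence-at {n} G v k W with W v in wv
... | true = begin
  oneIf (isIDSetOfSize G k W) ℕ.+ 0
    ≡⟨ +-comm _ 0 ⟩
  oneIf (isIDSetOfSize G k W)
    ≡⟨ cong (λ b → oneIf (b ∧ (size W ≡ᵇ k)))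
            (isIndepDominating-⊙-member G v W (subst T (≡-sym wv) _)) ⟩
  oneIf (isIDSetOfSize (G ⊙ v) k W) ∎
... | false = begin
  oneIf (isIDSetOfSize G k W) ℕ.+ oneIf (isIDSetOfSize (H − v) k W⁻)
    ≡⟨ cong (λ x → oneIf x ℕ.+ oneIf (b ∧ s)) (isIDSetOfSize-avoiding G v k W wv) ⟩
  oneIf ((a ∧ m) ∧ s) ℕ.+ oneIf (b ∧ s)
    ≡⟨ oneIf-exchange a b m s (isIndepDominating-⊙-deleted G v W⁻) ⟩
  oneIf (a ∧ s) ℕ.+ oneIf ((b ∧ m) ∧ s)
    ≡⟨ cong (λ c → oneIf (a ∧ s) ℕ.+ oneIf ((b ∧ c) ∧ s)) (meetsNeighbourhood-⊙ G v W⁻) ⟨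
  oneIf (isIDSetOfSize (G − v) k W⁻) ℕ.+ oneIf ((b ∧ meetsNeighbourhood H v W⁻) ∧ s)
    ≡⟨ cong (λ x → oneIf (a ∧ s) ℕ.+ oneIf x) (isIDSetOfSize-avoiding H v k W wv) ⟨
  oneIf (isIDSetOfSize (G − v) k W⁻) ℕ.+ oneIf (isIDSetOfSize H k W) ∎
  where
  H : Graph (suc n)
  H  = G ⊙ v
  W⁻ : Subset n
  W⁻ = removeAt W v
  a b m s : Bool
  a  = isIndepDominating (G − v) W⁻
  b  = isIndepDominating (H − v) W⁻
  m  = meetsNeighbourhood G v W⁻
  s  = size W⁻ ≡ᵇ k

recurrence-ℕ : ∀ {n} (G : Graph (suc n)) (v : Fin (suc n)) (k : ℕ) →
  idCount G k ℕ.+ idCount ((G ⊙ v) − v) k ≡ idCount (G − v) k ℕ.+ idCount (G ⊙ v) k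
recurrence-ℕ {n} G v k = begin
  count (IDS G) S ℕ.+ count (IDS (H − v)) S⁻
    ≡⟨ cong (count (IDS G) S ℕ.+_) (count-avoiding v (IDS (H − v)) (isIDSetOfSize-ext (H − v) k)) ⟨
  count (IDS G) S ℕ.+ count (avoiding v (IDS (H − v))) S
    ≡⟨ count-exchange (IDS G) (avoiding v (IDS (H − v))) (avoiding v (IDS (G − v))) (IDS H)
                      (recurrence-at G v k) S ⟩
  count (avoiding v (IDS (G − v))) S ℕ.+ count (IDS H) S
    ≡⟨ cong (ℕ._+ count (IDS H) S) (count-avoiding v (IDS (G − v)) (isIDSetOfSize-ext (G − v) k)) ⟩
  count (IDS (G − v)) S⁻ ℕ.+ count (IDS H) S ∎
  where
  H : Graph (suc n)
  H = G ⊙ v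
  IDS : ∀ {m} → Graph m → Subset m → Bool
  IDS X = isIDSetOfSize X k
  S : List (Subset (suc n))
  S = allSubsets (suc n)
  S⁻ : List (Subset n)
  S⁻ = allSubsets n

subtract-in-ℤ : ∀ a b c d → a ℕ.+ d ≡ b ℕ.+ c → + a ≡ (+ b + + c) - + d
subtract-in-ℤ a b c d a+d≡b+c = ≡-sym (begin
  (+ b + + c) - + d    ≡⟨ cong (_- + d) (ℤ.pos-+ b c) ⟨
  + (b ℕ.+ c) - + d    ≡⟨ cong (λ x → + x - + d) a+d≡b+c ⟨
  + (a ℕ.+ d) - + d    ≡⟨ cong (_- + d) (ℤ.pos-+ a d) ⟩
  (+ a + + d) - + d    ≡⟨ ℤ.+-assoc (+ a) (+ d) (- + d) ⟩
  + a + (+ d - + d)    ≡⟨ cong (λ x → + a + x) (ℤ.+-inverseʳ (+ d)) ⟩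
  + a + 0ℤ             ≡⟨ ℤ.+-identityʳ (+ a) ⟩
  + a                  ∎)

mainTheorem14 : ∀ {n} (G : Graph (suc n)) (v : Fin (suc n)) (k : ℕ) →
    ID G k ≡ (ID (G − v) k + ID (G ⊙ v) k) - ID ((G ⊙ v) − v) k
mainTheorem14 G v k = begin
  ID G k
    ≡⟨ ID≡idCount G k ⟩
  + idCount G k
    ≡⟨ subtract-in-ℤ (idCount G k) (idCount (G − v) k) (idCount (G ⊙ v) k) (idCount ((G ⊙ v) − v) k)
                     (recurrence-ℕ G v k) ⟩
  (+ idCount (G − v) k + + idCount (G ⊙ v) k) - + idCount ((G ⊙ v) − v) k
    ≡⟨ cong₂ _-_ (cong₂ _+_ (ID≡idCount (G − v) k) (ID≡idCount (G ⊙ v) k))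
                 (ID≡idCount ((G ⊙ v) − v) k) ⟨
  (ID (G − v) k + ID (G ⊙ v) k) - ID ((G ⊙ v) − v) k ∎
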